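{- Let $k\in\mathbb{Z}^+$, $n\ge 2k+1$, and let $i,j\in[n]$ be distinct. For every $y\in[n]\setminus\{i,j\}$, the number of permutations $\pi\in\mathcal{S}_n$ satisfying $\pi^k(i)=j$ and $\pi^k(j)=y$ is $$\left(n-\tau(k)-\tau_{\mathrm{o}}(k)\right)(n-3)!.$$
   Context: $\mathcal{S}_n$ is the symmetric group on $[n]=\{1,\dots,n\}$. $\tau(k)$ is the number of positive divisors of $k$, and $\tau_{\mathrm{o}}(k)=\tau(k/2^{\nu_2(k)})$ is the number of odd positive divisors of $k$, where $\nu_2(k)$ is the exponent of $2$ in $k$. -}

module Defs where

open import Data.Nat using (ℕ; zero; suc; _+_; _*_; _∸_; _%_)
open import Data.Nat.Divisibility using (_∣_; _∣?_)
open import Data.Fin using (Fin)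
open import Data.Fin.Properties using (all?; _≟_)
open import Data.Vec using (Vec; []; _∷_; lookup; tabulate)
open import Data.List using (List; []; _∷_; filter; length; concatMap; map; upTo; allFin)
open import Function using (_∘_)
open import Relation.Binary.PropositionalEquality using (_≡_)
open import Relation.Nullary using (Dec; ¬_)
open import Relation.Nullary.Decidable using (_×-dec_; _→-dec_)

-- All functions [m] → [n], represented as vectors of images (length m).
allVecs : (m n : ℕ) → List (Vec (Fin n) m)
allVecs zero    n = [] ∷ []
allVecs (suc m) n = concatMap (λ x → map (x ∷_) (allVecs m n)) (allFin n)

-- A map Fin n → Fin n is a permutation iff it is injective.
IsPerm : ∀ {n} → Vec (Fin n) n → Set
IsPerm {n} v = ∀ a b → lookup v a ≡ lookup v b → a ≡ b

isPerm? : ∀ {n} (v : Vec (Fin n) n) → Dec (IsPerm v)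
isPerm? {n} v = all? λ a → all? λ b → (lookup v a ≟ lookup v b) →-dec (a ≟ b)

Sym : (n : ℕ) → List (Vec (Fin n) n)
Sym n = filter isPerm? (allVecs n n)

iter : ∀ {n} → Vec (Fin n) n → ℕ → Fin n → Fin n
iter π zero    x = x
iter π (suc k) x = lookup π (iter π k x)

count : (n k : ℕ) (i j y : Fin n) → ℕ
count n k i j y =
  length (filter (λ π → (iter π k i ≟ j) ×-dec (iter π k j ≟ y)) (Sym n))

τ : ℕ → ℕ
τ k = length (filter (λ d → d ∣? k) (map suc (upTo k)))

τₒ : ℕ → ℕ
τₒ k = length (filter (λ d → (d ∣? k) ×-dec (d % 2 Data.Nat.≟ 1)) (map suc (upTo k)))

{-# OPTIONS --safe #-}

-- Sort the permutations by the cycle through i: its length L = ℓ + 1 and its word s = (π i, …, π^ℓ i).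
-- Both conditions depend on this cycle only: π^k i = j and π^k j = π^{2k} i = y say that the closed
-- word i s₁ … s_ℓ carries j at position k mod L and y at position 2k mod L, and once the cycle is fixed
-- the rest of π is an arbitrary permutation of the remaining n − L points. If L ∣ 2k no word qualifies
-- (it would force y = i); otherwise the two positions are nonzero and distinct, there are
-- (n − 3)! / (n − L)! qualifying words, and the cycle length L contributes exactly (n − 3)!. Since
-- 2k < n, the lengths L ≤ n dividing 2k are the τ(2k) = τ(k) + τₒ(k) divisors of 2k. Both counts of
-- words are instances of one count of injective words with some letters prescribed and some values
-- forbidden, a falling factorial.

module Submission where

open import Defs
open import Level using (Level; 0ℓ)
open import Data.Bool using (true; false; if_then_else_)
open import Data.Nat using (NonZero; ℕ; zero; suc; pred; _+_; _*_; _∸_; _≤_; _<_; z≤n; s≤s; s≤s⁻¹; _%_; _/_; _!) renaming (_≟_ to _≟ℕ_)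
open import Data.Nat.DivMod using (*-/-assoc; m/n*n≡m; m%n<n; m≡m%n+[m/n]*n; %-distribˡ-+; [m+kn]%n≡m%n; m*n%n≡0)
open import Data.Nat.Divisibility using (_∣_; _∣?_; m≤n⇒m!∣n!; m%n≡0⇒n∣m; n∣m⇒m%n≡0; ∣⇒≤; 0∣⇒≡0; ∣-trans; m∣m*n; *-cancelʳ-∣; *-monoˡ-∣)
open import Data.Nat.Coprimality using (Coprime; coprime-divisor)
open import Data.Nat.Combinatorics using (_P_; nPk≡n!/[n∸k]!; k>n⇒nPk≡0; nPn≡n!)
open import Data.Nat.Properties hiding (_≟_)
import Data.Nat.ListAction as ℕ
open import Data.Nat.ListAction.Properties using (sum-++)
open import Algebra.Properties.CommutativeSemigroup +-commutativeSemigroup using () renaming (interchange to +-interchange)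
open import Algebra.Properties.Semiring.Sum +-*-semiring using (sum-syntax; sum-cong-≗; sum-replicate-zero; sum-remove; *-distribʳ-sum) renaming (∑-distrib-+ to ∑<-distrib-+; ∑-comm to ∑<-comm)
open import Data.Fin using (Fin; zero; suc; toℕ; fromℕ<; punchIn)
open import Data.Fin.Properties using (_≟_; any?; all?; punchInᵢ≢i; pigeonhole; toℕ<n; toℕ-fromℕ<; toℕ-injective; toℕ-inject; ¬∀⟶∃¬-smallest) renaming (suc-injective to Fin-suc-injective)
open import Data.List using (List; []; _∷_; _++_; length; filter; map; concatMap; allFin; tabulate; applyUpTo; upTo)
open import Data.List.Properties using (filter-≐; filter-none; map-++; map-cong; map-∘)
import Data.List.Relation.Unary.All as All
open import Data.Vec using (Vec; []; _∷_; lookup) renaming (tabulate to tabulateᵛ)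
open import Data.Vec.Properties using (lookup∘tabulate; tabulate∘lookup; tabulate-cong; ∷-injectiveˡ; ∷-injectiveʳ) renaming (≡-dec to ≡-decᵛ)
open import Data.Product using (∃; _×_; _,_; proj₁; proj₂)
open import Data.Sum using (_⊎_; inj₁; inj₂)
open import Data.Empty using (⊥; ⊥-elim)
open import Function using (_∘_; case_of_)
open import Function.Bundles using (_⇔_; mk⇔; Equivalence)
open import Relation.Nullary using (Dec; yes; no; ¬_; does)
open import Relation.Binary.Definitions using (tri<; tri≈; tri>)
open import Relation.Nullary.Decidable using (decidable-stable; _×-dec_; _⊎-dec_; ¬?; _→-dec_)
open import Relation.Unary using (Pred; Decidable; _⊆_; _≐_; _∪_; ｛_｝)
open import Relation.Unary.Properties using (∁?; _∪?_)
open import Relation.Binary.PropositionalEquality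

private variable
  a b p q : Level
  A : Set a
  B : Set b

ind : {P : Set p} → Dec P → ℕ
ind d = if does d then 1 else 0

ind-yes : {P : Set p} (d : Dec P) → P → ind d ≡ 1
ind-yes (yes _) _ = refl
ind-yes (no ¬p) p = ⊥-elim (¬p p)

ind-no : {P : Set p} (d : Dec P) → ¬ P → ind d ≡ 0
ind-no (yes p) ¬p = ⊥-elim (¬p p)
ind-no (no _) _ = refl

ind-cong : {P : Set p} {Q : Set q} (d : Dec P) (e : Dec Q) → (P → Q) → (Q → P) → ind d ≡ ind e
ind-cong (yes p) e f g = sym (ind-yes e (f p))
ind-cong (no ¬p) e f g = sym (ind-no e (¬p ∘ g))

sumOver : List A → (A → ℕ) → ℕ
sumOver xs f = ℕ.sum (map f xs)

syntax sumOver xs (λ x → e) = ∑[ x ∈ xs ] e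

∑-cong : (xs : List A) {f g : A → ℕ} → (∀ x → f x ≡ g x) → ∑[ x ∈ xs ] f x ≡ ∑[ x ∈ xs ] g x
∑-cong xs f≗g = cong ℕ.sum (map-cong f≗g xs)

∑-zero : (xs : List A) {f : A → ℕ} → (∀ x → f x ≡ 0) → ∑[ x ∈ xs ] f x ≡ 0
∑-zero [] _ = refl
∑-zero (x ∷ xs) f≡0 = cong₂ _+_ (f≡0 x) (∑-zero xs f≡0)

∑-distrib-+ : (xs : List A) (f g : A → ℕ) → ∑[ x ∈ xs ] (f x + g x) ≡ ∑[ x ∈ xs ] f x + ∑[ x ∈ xs ] g x
∑-distrib-+ [] f g = refl
∑-distrib-+ (x ∷ xs) f g =
  trans (cong (f x + g x +_) (∑-distrib-+ xs f g)) (+-interchange (f x) (g x) _ _)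

∑-*ʳ : (xs : List A) (f : A → ℕ) (c : ℕ) → ∑[ x ∈ xs ] (f x * c) ≡ (∑[ x ∈ xs ] f x) * c
∑-*ʳ [] f c = refl
∑-*ʳ (x ∷ xs) f c = trans (cong (f x * c +_) (∑-*ʳ xs f c)) (sym (*-distribʳ-+ c (f x) _))

∑-map : (xs : List A) (g : A → B) (f : B → ℕ) → ∑[ y ∈ map g xs ] f y ≡ ∑[ x ∈ xs ] f (g x)
∑-map xs g f = cong ℕ.sum (sym (map-∘ xs))

∑-concatMap : (xs : List A) (g : A → List B) (f : B → ℕ) →
  ∑[ y ∈ concatMap g xs ] f y ≡ ∑[ x ∈ xs ] ∑[ y ∈ g x ] f y
∑-concatMap [] g f = refl
∑-concatMap (x ∷ xs) g f = begin
  ℕ.sum (map f (g x ++ concatMap g xs))            ≡⟨ cong ℕ.sum (map-++ f (g x) _) ⟩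
  ℕ.sum (map f (g x) ++ map f (concatMap g xs))    ≡⟨ sum-++ (map f (g x)) _ ⟩
  ∑[ y ∈ g x ] f y + ∑[ y ∈ concatMap g xs ] f y   ≡⟨ cong (∑[ y ∈ g x ] f y +_) (∑-concatMap xs g f) ⟩
  ∑[ y ∈ g x ] f y + ∑[ x ∈ xs ] ∑[ y ∈ g x ] f y  ∎
  where open ≡-Reasoning

∑-comm : {S : Set b} (xs : List A) (ss : List S) (f : A → S → ℕ) →
  ∑[ x ∈ xs ] ∑[ s ∈ ss ] f x s ≡ ∑[ s ∈ ss ] ∑[ x ∈ xs ] f x s
∑-comm [] ss f = sym (∑-zero ss (λ _ → refl))
∑-comm (x ∷ xs) ss f =
  trans (cong (∑[ s ∈ ss ] f x s +_) (∑-comm xs ss f)) (sym (∑-distrib-+ ss (f x) _))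

module _ {P : Pred A p} (P? : Decidable P) where

  ∑-ind : (xs : List A) → ∑[ x ∈ xs ] ind (P? x) ≡ length (filter P? xs)
  ∑-ind [] = refl
  ∑-ind (x ∷ xs) with does (P? x)
  ... | true = cong suc (∑-ind xs)
  ... | false = ∑-ind xs

  length-filter-none : (∀ x → ¬ P x) → (xs : List A) → length (filter P? xs) ≡ 0
  length-filter-none ¬P xs = cong length (filter-none P? (All.universal ¬P xs))

length-filter-map : {P : Pred A p} (P? : Decidable P) (g : B → A) (xs : List B) → length (filter P? (map g xs)) ≡ length (filter (P? ∘ g) xs)
length-filter-map P? g xs = begin
  length (filter P? (map g xs))     ≡⟨ ∑-ind P? (map g xs) ⟨
  ∑[ y ∈ map g xs ] ind (P? y)      ≡⟨ ∑-map xs g (ind ∘ P?) ⟩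
  ∑[ x ∈ xs ] ind (P? (g x))        ≡⟨ ∑-ind (P? ∘ g) xs ⟩
  length (filter (P? ∘ g) xs)       ∎
  where open ≡-Reasoning

length-filter-concatMap : {P : Pred A p} (P? : Decidable P) (g : B → List A) (xs : List B) →
  length (filter P? (concatMap g xs)) ≡ ∑[ x ∈ xs ] length (filter P? (g x))
length-filter-concatMap P? g xs = begin
  length (filter P? (concatMap g xs))           ≡⟨ ∑-ind P? (concatMap g xs) ⟨
  ∑[ y ∈ concatMap g xs ] ind (P? y)            ≡⟨ ∑-concatMap xs g (ind ∘ P?) ⟩
  ∑[ x ∈ xs ] ∑[ y ∈ g x ] ind (P? y)           ≡⟨ ∑-cong xs (∑-ind P? ∘ g) ⟩
  ∑[ x ∈ xs ] length (filter P? (g x))          ∎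
  where open ≡-Reasoning

length-filter-≐ : {P : Pred A p} {Q : Pred A q} (P? : Decidable P) (Q? : Decidable Q) → P ≐ Q →
  (xs : List A) → length (filter P? xs) ≡ length (filter Q? xs)
length-filter-≐ P? Q? P≐Q xs = cong length (filter-≐ P? Q? P≐Q xs)

length-filter-filter : {P : Pred A p} {Q : Pred A q} (P? : Decidable P) (Q? : Decidable Q) (xs : List A) →
  length (filter P? (filter Q? xs)) ≡ length (filter (λ x → Q? x ×-dec P? x) xs)
length-filter-filter P? Q? [] = refl
length-filter-filter P? Q? (x ∷ xs) with Q? x
... | no _ = length-filter-filter P? Q? xs
... | yes _ with does (P? x)
...   | true = cong suc (length-filter-filter P? Q? xs)
...   | false = length-filter-filter P? Q? xs

length-filter-partition : {S : Set b} {Q : Pred A q} {R : S → Pred A p}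
  (Q? : Decidable Q) (R? : ∀ s → Decidable (R s)) (ss : List S) →
  (∀ x → ∑[ s ∈ ss ] ind (R? s x) ≡ ind (Q? x)) →
  (xs : List A) → length (filter Q? xs) ≡ ∑[ s ∈ ss ] length (filter (R? s) xs)
length-filter-partition Q? R? ss cover xs = begin
  length (filter Q? xs)                      ≡⟨ ∑-ind Q? xs ⟨
  ∑[ x ∈ xs ] ind (Q? x)                     ≡⟨ ∑-cong xs cover ⟨
  ∑[ x ∈ xs ] ∑[ s ∈ ss ] ind (R? s x)       ≡⟨ ∑-comm xs ss (λ x s → ind (R? s x)) ⟩
  ∑[ s ∈ ss ] ∑[ x ∈ xs ] ind (R? s x)       ≡⟨ ∑-cong ss (λ s → ∑-ind (R? s) xs) ⟩
  ∑[ s ∈ ss ] length (filter (R? s) xs)      ∎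
  where open ≡-Reasoning

∑-tabulate : ∀ {n} (g : Fin n → A) (f : A → ℕ) → ∑[ x ∈ tabulate g ] f x ≡ ∑[ i < n ] f (g i)
∑-tabulate {n = zero} g f = refl
∑-tabulate {n = suc n} g f = cong (f (g zero) +_) (∑-tabulate (g ∘ suc) f)

∑-allFin : ∀ n (f : Fin n → ℕ) → ∑[ i ∈ allFin n ] f i ≡ ∑[ i < n ] f i
∑-allFin n f = ∑-tabulate (λ i → i) f

∑<-zero : ∀ n {f : Fin n → ℕ} → (∀ i → f i ≡ 0) → ∑[ i < n ] f i ≡ 0
∑<-zero n f≡0 = trans (sum-cong-≗ f≡0) (sum-replicate-zero n)

∑<-single : ∀ {n} (f : Fin n → ℕ) (b : Fin n) → (∀ i → ¬ i ≡ b → f i ≡ 0) → ∑[ i < n ] f i ≡ f b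
∑<-single {suc n} f b f≡0 = begin
  ∑[ i < suc n ] f i                      ≡⟨ sum-remove {i = b} f ⟩
  f b + ∑[ j < n ] f (punchIn b j)        ≡⟨ cong (f b +_) (∑<-zero n (λ j → f≡0 _ (punchInᵢ≢i b j))) ⟩
  f b + 0                                 ≡⟨ +-identityʳ (f b) ⟩
  f b                                     ∎
  where open ≡-Reasoning

∑<-1 : ∀ n → ∑[ i < n ] 1 ≡ n
∑<-1 zero = refl
∑<-1 (suc n) = cong suc (∑<-1 n)

∑-applyUpTo : (f : ℕ → A) (n : ℕ) (g : A → ℕ) → ∑[ x ∈ applyUpTo f n ] g x ≡ ∑[ t < n ] g (f (toℕ t))
∑-applyUpTo f zero g = refl
∑-applyUpTo f (suc n) g = cong (g (f 0) +_) (∑-applyUpTo (f ∘ suc) n g)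

length-filter-positives : {P : Pred ℕ p} (P? : Decidable P) (n : ℕ) →
  length (filter P? (map suc (upTo n))) ≡ ∑[ t < n ] ind (P? (suc (toℕ t)))
length-filter-positives P? n = begin
  length (filter P? (map suc (upTo n)))     ≡⟨ ∑-ind P? (map suc (upTo n)) ⟨
  ∑[ d ∈ map suc (upTo n) ] ind (P? d)      ≡⟨ ∑-map (upTo n) suc (ind ∘ P?) ⟩
  ∑[ t ∈ upTo n ] ind (P? (suc t))          ≡⟨ ∑-applyUpTo (λ t → t) n (λ t → ind (P? (suc t))) ⟩
  ∑[ t < n ] ind (P? (suc (toℕ t)))          ∎
  where open ≡-Reasoning

∑<-+ : ∀ a b (g : ℕ → ℕ) → ∑[ t < a + b ] g (toℕ t) ≡ ∑[ t < a ] g (toℕ t) + ∑[ t < b ] g (a + toℕ t)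
∑<-+ zero b g = refl
∑<-+ (suc a) b g = trans (cong (g 0 +_) (∑<-+ a b (g ∘ suc))) (sym (+-assoc (g 0) _ _))

∑<-truncate : ∀ {a n} (g : ℕ → ℕ) → a ≤ n → (∀ t → g (a + t) ≡ 0) → ∑[ t < n ] g (toℕ t) ≡ ∑[ t < a ] g (toℕ t)
∑<-truncate {a} {n} g a≤n g≡0 = begin
  ∑[ t < n ] g (toℕ t)                                        ≡⟨ cong (λ m → ∑[ t < m ] g (toℕ t)) (m+[n∸m]≡n a≤n) ⟨
  ∑[ t < a + (n ∸ a) ] g (toℕ t)                              ≡⟨ ∑<-+ a (n ∸ a) g ⟩
  ∑[ t < a ] g (toℕ t) + ∑[ t < n ∸ a ] g (a + toℕ t)         ≡⟨ cong (∑[ t < a ] g (toℕ t) +_) (∑<-zero (n ∸ a) (g≡0 ∘ toℕ)) ⟩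
  ∑[ t < a ] g (toℕ t) + 0                                    ≡⟨ +-identityʳ _ ⟩
  ∑[ t < a ] g (toℕ t)                                        ∎
  where open ≡-Reasoning

∑<-pairs : ∀ d (g : ℕ → ℕ) → ∑[ t < d * 2 ] g (toℕ t) ≡ ∑[ t < d ] (g (toℕ t * 2) + g (suc (toℕ t * 2)))
∑<-pairs zero g = refl
∑<-pairs (suc d) g = begin
  g 0 + (g 1 + ∑[ t < d * 2 ] g (2 + toℕ t))                              ≡⟨ cong (λ r → g 0 + (g 1 + r)) (∑<-pairs d (λ t → g (suc (suc t)))) ⟩
  g 0 + (g 1 + ∑[ t < d ] (g (2 + toℕ t * 2) + g (3 + toℕ t * 2)))        ≡⟨ +-assoc (g 0) (g 1) _ ⟨
  g 0 + g 1 + ∑[ t < d ] (g (2 + toℕ t * 2) + g (3 + toℕ t * 2))          ∎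
  where open ≡-Reasoning

#_ : ∀ {n} {P : Pred (Fin n) p} → Decidable P → ℕ
#_ {n = n} P? = ∑[ i < n ] ind (P? i)

#∁+#≡n : ∀ {n} {P : Pred (Fin n) p} (P? : Decidable P) → # (∁? P?) + # P? ≡ n
#∁+#≡n {n = zero} P? = refl
#∁+#≡n {n = suc n} P? with P? zero
... | yes _ = trans (+-suc _ _) (cong suc (#∁+#≡n (P? ∘ suc)))
... | no _ = cong suc (#∁+#≡n (P? ∘ suc))

#-none : ∀ {n} {P : Pred (Fin n) p} (P? : Decidable P) → (∀ i → ¬ P i) → # P? ≡ 0
#-none P? ¬P = ∑<-zero _ (λ i → ind-no (P? i) (¬P i))

#-unique : ∀ {n} {P : Pred (Fin n) p} (P? : Decidable P) {b : Fin n} → P b → (∀ {i} → P i → i ≡ b) → # P? ≡ 1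
#-unique P? Pb unique = trans (∑<-single _ _ (λ i i≢b → ind-no (P? i) (i≢b ∘ unique))) (ind-yes (P? _) Pb)

#-singleton : ∀ {n} (x : Fin n) → # (x ≟_) ≡ 1
#-singleton x = #-unique (x ≟_) refl sym

#-∪ : ∀ {n} {P : Pred (Fin n) p} {Q : Pred (Fin n) q} (P? : Decidable P) (Q? : Decidable Q) →
  (∀ {i} → P i → ¬ Q i) → # (P? ∪? Q?) ≡ # P? + # Q?
#-∪ {P = P} {Q} P? Q? disjoint = trans (sum-cong-≗ (λ i → ind-⊎ (P? i) (Q? i))) (∑<-distrib-+ (ind ∘ P?) (ind ∘ Q?))
  where
  ind-⊎ : ∀ {i} (d : Dec (P i)) (e : Dec (Q i)) → ind (d ⊎-dec e) ≡ ind d + ind e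
  ind-⊎ (yes p) (yes q) = ⊥-elim (disjoint p q)
  ind-⊎ (yes _) (no _) = refl
  ind-⊎ (no _) (yes _) = refl
  ind-⊎ (no _) (no _) = refl

#∁≡n∸# : ∀ {n} {P : Pred (Fin n) p} (P? : Decidable P) → # (∁? P?) ≡ n ∸ # P?
#∁≡n∸# P? = trans (sym (m+n∸n≡m _ (# P?))) (cong (_∸ # P?) (#∁+#≡n P?))

#≤n : ∀ {n} {P : Pred (Fin n) p} (P? : Decidable P) → # P? ≤ n
#≤n P? = subst (# P? ≤_) (#∁+#≡n P?) (m≤n+m _ _)

#-image : ∀ {n L} (h : Fin L → Fin n) → (∀ r s → h r ≡ h s → r ≡ s) →
  {Q : Pred (Fin n) q} (Q? : Decidable Q) → Q ≐ (λ b → ∃ λ r → h r ≡ b) → # Q? ≡ L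
#-image {n = n} {L = L} h h-injective Q? (Q⊆image , image⊆Q) = begin
  ∑[ b < n ] ind (Q? b)                      ≡⟨ sum-cong-≗ fibre ⟩
  ∑[ b < n ] ∑[ r < L ] ind (h r ≟ b)        ≡⟨ ∑<-comm (λ b r → ind (h r ≟ b)) ⟩
  ∑[ r < L ] ∑[ b < n ] ind (h r ≟ b)        ≡⟨ sum-cong-≗ (λ r → #-unique (h r ≟_) refl sym) ⟩
  ∑[ r < L ] 1                               ≡⟨ ∑<-1 L ⟩
  L                                          ∎
  where
  open ≡-Reasoning
  fibre : ∀ b → ind (Q? b) ≡ ∑[ r < L ] ind (h r ≟ b)
  fibre b with Q? b
  ... | yes Qb = sym (#-unique (λ r → h r ≟ b) (proj₂ (Q⊆image Qb)) (λ e → h-injective _ _ (trans e (sym (proj₂ (Q⊆image Qb))))))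
  ... | no ¬Qb = sym (#-none (λ r → h r ≟ b) (λ r e → ¬Qb (image⊆Q (r , e))))

nP[1+k]≡n[pred[n]Pk] : ∀ a r → a P suc r ≡ a * (pred a P r)
nP[1+k]≡n[pred[n]Pk] zero r = refl
nP[1+k]≡n[pred[n]Pk] (suc a) r with r ≤? a
... | yes r≤a = begin
  suc a P suc r               ≡⟨ nPk≡n!/[n∸k]! (s≤s r≤a) ⟩
  suc a ! / (a ∸ r) !         ≡⟨ *-/-assoc (suc a) (m≤n⇒m!∣n! (m∸n≤m a r)) ⟩
  suc a * (a ! / (a ∸ r) !)   ≡⟨ cong (suc a *_) (nPk≡n!/[n∸k]! r≤a) ⟨
  suc a * (a P r)             ∎
  where
  open ≡-Reasoning
  instance _ = (a ∸ r) !≢0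
... | no r≰a = begin
  suc a P suc r               ≡⟨ k>n⇒nPk≡0 (s≤s (≰⇒> r≰a)) ⟩
  0                           ≡⟨ *-zeroʳ (suc a) ⟨
  suc a * 0                   ≡⟨ cong (suc a *_) (k>n⇒nPk≡0 (≰⇒> r≰a)) ⟨
  suc a * (a P r)             ∎
  where open ≡-Reasoning

nPk*[n∸k]!≡n! : ∀ {n k} → k ≤ n → (n P k) * (n ∸ k) ! ≡ n !
nPk*[n∸k]!≡n! {n} {k} k≤n =
  trans (cong (_* (n ∸ k) !) (nPk≡n!/[n∸k]! k≤n)) (m/n*n≡m (m≤n⇒m!∣n! (m∸n≤m n k)))
  where instance _ = (n ∸ k) !≢0

[r+r]%n≡r⇒r≡0 : ∀ {r n} .{{_ : NonZero n}} → r < n → (r + r) % n ≡ r → r ≡ 0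
[r+r]%n≡r⇒r≡0 {r} {n} r<n e = helper ((r + r) / n) r≡qn
  where
  r≡qn : r ≡ ((r + r) / n) * n
  r≡qn = +-cancelˡ-≡ r r _ (trans (m≡m%n+[m/n]*n (r + r) n) (cong (_+ ((r + r) / n) * n) e))
  helper : ∀ q → r ≡ q * n → r ≡ 0
  helper zero r≡0 = r≡0
  helper (suc q) r≡n+qn = ⊥-elim (<⇒≱ r<n (subst (n ≤_) (sym r≡n+qn) (m≤m+n n (q * n))))

[n∸3]P[ℓ∸2]*[n∸1+ℓ]!≡[n∸3]! : ∀ {n ℓ} → 2 ≤ ℓ → suc ℓ ≤ n → ((n ∸ 3) P (ℓ ∸ 2)) * (n ∸ suc ℓ) ! ≡ (n ∸ 3) !
[n∸3]P[ℓ∸2]*[n∸1+ℓ]!≡[n∸3]! (s≤s (s≤s _)) (s≤s (s≤s (s≤s ℓ≤n))) = nPk*[n∸k]!≡n! ℓ≤n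

2≤-of-distinct : ∀ {a b ℓ} → a < ℓ → b < ℓ → ¬ a ≡ b → 2 ≤ ℓ
2≤-of-distinct {zero} {zero} _ _ a≢b = ⊥-elim (a≢b refl)
2≤-of-distinct {zero} {suc _} _ b<ℓ _ = ≤-trans (s≤s (s≤s z≤n)) b<ℓ
2≤-of-distinct {suc _} a<ℓ _ _ = ≤-trans (s≤s (s≤s z≤n)) a<ℓ

InjectiveWord : ∀ {m n} → Vec (Fin n) m → Set
InjectiveWord v = ∀ a b → lookup v a ≡ lookup v b → a ≡ b

injectiveWord? : ∀ {m n} → Decidable (InjectiveWord {m} {n})
injectiveWord? v = all? λ a → all? λ b → (lookup v a ≟ lookup v b) →-dec (a ≟ b)

InjectiveWord-∷ : ∀ {m n} {x : Fin n} {v : Vec (Fin n) m} →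
  InjectiveWord (x ∷ v) ⇔ (InjectiveWord v × ∀ a → ¬ x ≡ lookup v a)
InjectiveWord-∷ {x = x} {v} = mk⇔ to from
  where
  to : InjectiveWord (x ∷ v) → InjectiveWord v × ∀ a → ¬ x ≡ lookup v a
  to inj = (λ a c e → Fin-suc-injective (inj (suc a) (suc c) e)) , λ a x≡va → case inj zero (suc a) x≡va of λ ()
  from : InjectiveWord v × (∀ a → ¬ x ≡ lookup v a) → InjectiveWord (x ∷ v)
  from (inj , x∉v) zero zero _ = refl
  from (inj , x∉v) zero (suc c) e = ⊥-elim (x∉v c e)
  from (inj , x∉v) (suc a) zero e = ⊥-elim (x∉v a (sym e))
  from (inj , x∉v) (suc a) (suc c) e = cong suc (inj a c e)

module _ {n : ℕ} where

  Range : ∀ {m} → (Fin m → Pred (Fin n) 0ℓ) → Pred (Fin n) 0ℓ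
  Range R b = ∃ λ p → R p b

  Dom : ∀ {m} → (Fin m → Pred (Fin n) 0ℓ) → Pred (Fin m) 0ℓ
  Dom R p = ∃ (R p)

  record IsPartialInjection {m} (F : Pred (Fin n) 0ℓ) (R : Fin m → Pred (Fin n) 0ℓ) : Set where
    field
      functional : ∀ {p b c} → R p b → R p c → b ≡ c
      injective  : ∀ {p q b} → R p b → R q b → p ≡ q
      avoids     : ∀ {p b} → R p b → ¬ F b

  InjectiveExtension : ∀ {m} → Pred (Fin n) 0ℓ → (Fin m → Pred (Fin n) 0ℓ) → Pred (Vec (Fin n) m) 0ℓ
  InjectiveExtension F R v = InjectiveWord v × (∀ a → ¬ F (lookup v a)) × (∀ p b → R p b → lookup v p ≡ b)

  injectiveExtension? : ∀ {m F} {R : Fin m → Pred (Fin n) 0ℓ} → Decidable F → (∀ p → Decidable (R p)) →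
    Decidable (InjectiveExtension F R)
  injectiveExtension? F? R? v =
    injectiveWord? v ×-dec all? (λ a → ¬? (F? (lookup v a))) ×-dec
    all? (λ p → all? (λ b → R? p b →-dec (lookup v p ≟ b)))

  module _ {m} {F : Pred (Fin n) 0ℓ} {R : Fin (suc m) → Pred (Fin n) 0ℓ} {x : Fin n} where

    InjectiveExtension-∷ : ¬ F x → (∀ {c} → R zero c → x ≡ c) →
      (λ v → InjectiveExtension F R (x ∷ v)) ≐ InjectiveExtension (F ∪ ｛ x ｝) (R ∘ suc)
    InjectiveExtension-∷ ¬Fx head = to , from
      where
      to : ∀ {v} → InjectiveExtension F R (x ∷ v) → InjectiveExtension (F ∪ ｛ x ｝) (R ∘ suc) v
      to {v} (inj , avoid , ext) = proj₁ (Equivalence.to InjectiveWord-∷ inj) , avoid′ , ext ∘ suc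
        where
        avoid′ : ∀ a → ¬ (F ∪ ｛ x ｝) (lookup v a)
        avoid′ a (inj₁ f) = avoid (suc a) f
        avoid′ a (inj₂ x≡va) = proj₂ (Equivalence.to InjectiveWord-∷ inj) a x≡va
      from : ∀ {v} → InjectiveExtension (F ∪ ｛ x ｝) (R ∘ suc) v → InjectiveExtension F R (x ∷ v)
      from {v} (inj , avoid , ext) = Equivalence.from InjectiveWord-∷ (inj , λ a → avoid a ∘ inj₂) , avoid′ , ext′
        where
        avoid′ : ∀ a → ¬ F (lookup (x ∷ v) a)
        avoid′ zero = ¬Fx
        avoid′ (suc a) f = avoid a (inj₁ f)
        ext′ : ∀ p b → R p b → lookup (x ∷ v) p ≡ b
        ext′ zero b = head
        ext′ (suc p) = ext p

    IsPartialInjection-∷ : IsPartialInjection F R → (∀ {p} → ¬ R (suc p) x) → IsPartialInjection (F ∪ ｛ x ｝) (R ∘ suc)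
    IsPartialInjection-∷ pi x∉R = record
      { functional = functional
      ; injective  = λ r s → Fin-suc-injective (injective r s)
      ; avoids     = avoids′
      }
      where
      open IsPartialInjection pi
      avoids′ : ∀ {p b} → R (suc p) b → ¬ (F ∪ ｛ x ｝) b
      avoids′ r (inj₁ f) = avoids r f
      avoids′ r (inj₂ refl) = x∉R r

  ExtensionCount : ℕ → Set₁
  ExtensionCount m =
    ∀ {F : Pred (Fin n) 0ℓ} {R : Fin m → Pred (Fin n) 0ℓ} (F? : Decidable F) (R? : ∀ p → Decidable (R p)) →
    IsPartialInjection F R →
    {B : Pred (Fin n) 0ℓ} (B? : Decidable B) → B ≐ F ∪ Range R →
    {D : Pred (Fin m) 0ℓ} (D? : Decidable D) → D ≐ Dom R →
    length (filter (injectiveExtension? F? R?) (allVecs m n)) ≡ (n ∸ # B?) P (m ∸ # D?)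

  -- A prescribed first letter is forced; a free one ranges over the n − |B| unblocked values and then
  -- becomes blocked itself.
  module ExtensionStep {m} (ih : ExtensionCount m)
    {F : Pred (Fin n) 0ℓ} {R : Fin (suc m) → Pred (Fin n) 0ℓ} (F? : Decidable F) (R? : ∀ p → Decidable (R p))
    (pi : IsPartialInjection F R)
    {B : Pred (Fin n) 0ℓ} (B? : Decidable B) (B≐ : B ≐ F ∪ Range R)
    {D : Pred (Fin (suc m)) 0ℓ} (D? : Decidable D) (D≐ : D ≐ Dom R) where

    open IsPartialInjection pi
    open ≡-Reasoning

    E? : Decidable (InjectiveExtension F R)
    E? = injectiveExtension? F? R?

    withHead : Fin n → ℕ
    withHead x = length (filter (E? ∘ (x ∷_)) (allVecs m n))

    count-by-head : length (filter E? (allVecs (suc m) n)) ≡ ∑[ x < n ] withHead x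
    count-by-head = begin
      length (filter E? (concatMap (λ x → map (x ∷_) (allVecs m n)) (allFin n)))
        ≡⟨ length-filter-concatMap E? _ (allFin n) ⟩
      ∑[ x ∈ allFin n ] length (filter E? (map (x ∷_) (allVecs m n)))
        ≡⟨ ∑-allFin n _ ⟩
      ∑[ x < n ] length (filter E? (map (x ∷_) (allVecs m n)))
        ≡⟨ sum-cong-≗ (λ x → length-filter-map E? (x ∷_) (allVecs m n)) ⟩
      ∑[ x < n ] withHead x
        ∎

    withHead-count : ∀ {x} → ¬ F x → (∀ {c} → R zero c → x ≡ c) → (∀ {p} → ¬ R (suc p) x) →
      {B′ : Pred (Fin n) 0ℓ} (B′? : Decidable B′) → B′ ≐ (F ∪ ｛ x ｝) ∪ Range (R ∘ suc) →
      withHead x ≡ (n ∸ # B′?) P (m ∸ # (D? ∘ suc))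
    withHead-count ¬Fx head x∉R B′? B′≐ =
      trans (length-filter-≐ _ _ (InjectiveExtension-∷ ¬Fx head) (allVecs m n))
            (ih (F? ∪? (_ ≟_)) (R? ∘ suc) (IsPartialInjection-∷ pi x∉R) B′? B′≐ (D? ∘ suc) (proj₁ D≐ , proj₂ D≐))

    assigned : ∀ {b} → R zero b → length (filter E? (allVecs (suc m) n)) ≡ (n ∸ # B?) P (suc m ∸ # D?)
    assigned {b} Rb = begin
      length (filter E? (allVecs (suc m) n))   ≡⟨ count-by-head ⟩
      ∑[ x < n ] withHead x                     ≡⟨ ∑<-single withHead b only-b ⟩
      withHead b                                ≡⟨ withHead-count (avoids Rb) (functional Rb) b∉R B? (B⊆ , ⊆B) ⟩
      (n ∸ # B?) P (m ∸ # (D? ∘ suc))           ≡⟨ cong (λ d → (n ∸ # B?) P (suc m ∸ d)) #D ⟨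
      (n ∸ # B?) P (suc m ∸ # D?)               ∎
      where
      only-b : ∀ x → ¬ x ≡ b → withHead x ≡ 0
      only-b x x≢b = length-filter-none _ (λ _ (_ , _ , ext) → x≢b (ext zero b Rb)) (allVecs m n)
      b∉R : ∀ {p} → ¬ R (suc p) b
      b∉R Rpb with injective Rb Rpb
      ... | ()
      B⊆ : B ⊆ (F ∪ ｛ b ｝) ∪ Range (R ∘ suc)
      B⊆ Bc with proj₁ B≐ Bc
      ... | inj₁ Fc = inj₁ (inj₁ Fc)
      ... | inj₂ (zero , Rc) = inj₁ (inj₂ (functional Rb Rc))
      ... | inj₂ (suc p , Rpc) = inj₂ (p , Rpc)
      ⊆B : (F ∪ ｛ b ｝) ∪ Range (R ∘ suc) ⊆ B
      ⊆B (inj₁ (inj₁ Fc)) = proj₂ B≐ (inj₁ Fc)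
      ⊆B (inj₁ (inj₂ refl)) = proj₂ B≐ (inj₂ (zero , Rb))
      ⊆B (inj₂ (p , Rpc)) = proj₂ B≐ (inj₂ (suc p , Rpc))
      #D : # D? ≡ suc (# (D? ∘ suc))
      #D = cong (_+ # (D? ∘ suc)) (ind-yes (D? zero) (proj₂ D≐ (b , Rb)))

    module Free (¬R₀ : ¬ Dom R zero) where

      private
        d = # (D? ∘ suc)
        K = (n ∸ suc (# B?)) P (m ∸ d)

      withHead-blocked : ∀ {x} → B x → withHead x ≡ 0
      withHead-blocked {x} Bx = length-filter-none _ blocked (allVecs m n)
        where
        blocked : ∀ v → ¬ InjectiveExtension F R (x ∷ v)
        blocked v (inj , avoid , ext) with proj₁ B≐ Bx
        ... | inj₁ Fx = avoid zero Fx
        ... | inj₂ (zero , Rx) = ¬R₀ (_ , Rx)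
        ... | inj₂ (suc p , Rpx) with inj (suc p) zero (ext (suc p) _ Rpx)
        ...   | ()

      withHead-unblocked : ∀ {x} → ¬ B x → withHead x ≡ K
      withHead-unblocked {x} ¬Bx = trans
        (withHead-count (¬Bx ∘ proj₂ B≐ ∘ inj₁) (λ R₀c → ⊥-elim (¬R₀ (_ , R₀c))) (λ Rpx → ¬Bx (proj₂ B≐ (inj₂ (suc _ , Rpx))))
                        (B? ∪? (x ≟_)) (B′⊆ , ⊆B′))
        (cong (λ b → (n ∸ b) P (m ∸ d)) #B′)
        where
        #B′ : # (B? ∪? (x ≟_)) ≡ suc (# B?)
        #B′ = trans (#-∪ B? (x ≟_) (λ Bc x≡c → ¬Bx (subst B (sym x≡c) Bc)))
                    (trans (cong (# B? +_) (#-singleton x)) (+-comm (# B?) 1))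
        B′⊆ : B ∪ ｛ x ｝ ⊆ (F ∪ ｛ x ｝) ∪ Range (R ∘ suc)
        B′⊆ (inj₂ x≡c) = inj₁ (inj₂ x≡c)
        B′⊆ (inj₁ Bc) with proj₁ B≐ Bc
        ... | inj₁ Fc = inj₁ (inj₁ Fc)
        ... | inj₂ (zero , Rc) = ⊥-elim (¬R₀ (_ , Rc))
        ... | inj₂ (suc p , Rpc) = inj₂ (p , Rpc)
        ⊆B′ : (F ∪ ｛ x ｝) ∪ Range (R ∘ suc) ⊆ B ∪ ｛ x ｝
        ⊆B′ (inj₁ (inj₁ Fc)) = inj₁ (proj₂ B≐ (inj₁ Fc))
        ⊆B′ (inj₁ (inj₂ x≡c)) = inj₂ x≡c
        ⊆B′ (inj₂ (p , Rpc)) = inj₁ (proj₂ B≐ (inj₂ (suc p , Rpc)))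

      withHead≡ : ∀ x → withHead x ≡ ind (∁? B? x) * K
      withHead≡ x with B? x
      ... | yes Bx = withHead-blocked Bx
      ... | no ¬Bx = trans (withHead-unblocked ¬Bx) (sym (+-identityʳ K))

      free : length (filter E? (allVecs (suc m) n)) ≡ (n ∸ # B?) P (suc m ∸ # D?)
      free = begin
        length (filter E? (allVecs (suc m) n))   ≡⟨ count-by-head ⟩
        ∑[ x < n ] withHead x                     ≡⟨ sum-cong-≗ withHead≡ ⟩
        ∑[ x < n ] (ind (∁? B? x) * K)            ≡⟨ *-distribʳ-sum K (ind ∘ ∁? B?) ⟨
        # (∁? B?) * K                             ≡⟨ cong (_* K) (#∁≡n∸# B?) ⟩
        (n ∸ # B?) * K                            ≡⟨ cong (λ a → (n ∸ # B?) * (a P (m ∸ d))) (pred[m∸n]≡m∸[1+n] n (# B?)) ⟨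
        (n ∸ # B?) * (pred (n ∸ # B?) P (m ∸ d))  ≡⟨ nP[1+k]≡n[pred[n]Pk] (n ∸ # B?) (m ∸ d) ⟨
        (n ∸ # B?) P suc (m ∸ d)                  ≡⟨ cong ((n ∸ # B?) P_) (+-∸-assoc 1 (#≤n (D? ∘ suc))) ⟨
        (n ∸ # B?) P (suc m ∸ d)                  ≡⟨ cong (λ e → (n ∸ # B?) P (suc m ∸ e)) #D ⟨
        (n ∸ # B?) P (suc m ∸ # D?)               ∎
        where
        #D : # D? ≡ d
        #D = cong (_+ d) (ind-no (D? zero) (¬R₀ ∘ proj₁ D≐))

  count-injectiveExtensions : ∀ m → ExtensionCount m
  count-injectiveExtensions zero F? R? pi B? B≐ D? D≐ = refl
  count-injectiveExtensions (suc m) F? R? pi B? B≐ D? D≐ with any? (R? zero)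
  ... | yes (_ , R₀b) = ExtensionStep.assigned (count-injectiveExtensions m) F? R? pi B? B≐ D? D≐ R₀b
  ... | no ¬R₀ = ExtensionStep.Free.free (count-injectiveExtensions m) F? R? pi B? B≐ D? D≐ ¬R₀

lookupOr : ∀ {m} → Vec A m → A → ℕ → A
lookupOr [] d _ = d
lookupOr (x ∷ xs) d zero = x
lookupOr (x ∷ xs) d (suc t) = lookupOr xs d t

lookupOr-toℕ : ∀ {m} (xs : Vec A m) d (r : Fin m) → lookupOr xs d (toℕ r) ≡ lookup xs r
lookupOr-toℕ (x ∷ xs) d zero = refl
lookupOr-toℕ (x ∷ xs) d (suc r) = lookupOr-toℕ xs d r

lookupOr-fromℕ< : ∀ {m t} (xs : Vec A m) d (t<m : t < m) → lookupOr xs d t ≡ lookup xs (fromℕ< t<m)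
lookupOr-fromℕ< xs d t<m = trans (cong (lookupOr xs d) (sym (toℕ-fromℕ< t<m))) (lookupOr-toℕ xs d _)

lookupOr-length : ∀ {m} (xs : Vec A m) d → lookupOr xs d m ≡ d
lookupOr-length [] d = refl
lookupOr-length (x ∷ xs) d = lookupOr-length xs d

-- Position t of the closed word i s₁ … s_ℓ i; the default value i makes position suc ℓ close the cycle.
cycleAt : ∀ {n ℓ} → Fin n → Vec (Fin n) ℓ → ℕ → Fin n
cycleAt i s = lookupOr (i ∷ s) i

module _ {n : ℕ} (π : Vec (Fin n) n) where

  iter-+ : ∀ a b x → iter π (a + b) x ≡ iter π a (iter π b x)
  iter-+ zero b x = refl
  iter-+ (suc a) b x = cong (lookup π) (iter-+ a b x)

  iter-cancel : IsPerm π → ∀ a {x z} → iter π a x ≡ iter π a z → x ≡ z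
  iter-cancel perm zero e = e
  iter-cancel perm (suc a) e = iter-cancel perm a (perm _ _ e)

  iter-return : IsPerm π → ∀ {x u v} → u < v → iter π u x ≡ iter π v x → iter π (v ∸ u) x ≡ x
  iter-return perm {x} {u} {v} u<v e = sym (iter-cancel perm u (begin
    iter π u x                   ≡⟨ e ⟩
    iter π v x                   ≡⟨ cong (λ t → iter π t x) (m+[n∸m]≡n (<⇒≤ u<v)) ⟨
    iter π (u + (v ∸ u)) x       ≡⟨ iter-+ u (v ∸ u) x ⟩
    iter π u (iter π (v ∸ u) x)  ∎))
    where open ≡-Reasoning

  iter-*-fixed : ∀ {L x} → iter π L x ≡ x → ∀ q → iter π (q * L) x ≡ x
  iter-*-fixed e zero = refl
  iter-*-fixed {L} {x} e (suc q) = trans (iter-+ L (q * L) x) (trans (cong (iter π L) (iter-*-fixed e q)) e)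

  iter-% : ∀ {ℓ x} → iter π (suc ℓ) x ≡ x → ∀ t → iter π t x ≡ iter π (t % suc ℓ) x
  iter-% {ℓ} {x} e t = begin
    iter π t x                                          ≡⟨ cong (λ u → iter π u x) (m≡m%n+[m/n]*n t (suc ℓ)) ⟩
    iter π (t % suc ℓ + (t / suc ℓ) * suc ℓ) x           ≡⟨ iter-+ (t % suc ℓ) _ x ⟩
    iter π (t % suc ℓ) (iter π ((t / suc ℓ) * suc ℓ) x)  ≡⟨ cong (iter π (t % suc ℓ)) (iter-*-fixed e (t / suc ℓ)) ⟩
    iter π (t % suc ℓ) x                                ∎
    where open ≡-Reasoning

  return-within : IsPerm π → ∀ i → ∃ λ (t : Fin n) → iter π (suc (toℕ t)) i ≡ i
  return-within perm i with pigeonhole (n<1+n n) (λ (r : Fin (suc n)) → iter π (toℕ r) i)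
  ... | r₁ , r₂ , r₁<r₂ , e
      with toℕ r₂ ∸ toℕ r₁ | m<n⇒0<n∸m r₁<r₂ | m∸n≤m (toℕ r₂) (toℕ r₁) | iter-return perm r₁<r₂ e
  ...   | suc d | _ | d<r₂ | returns = fromℕ< d<n , subst (λ t → iter π (suc t) i ≡ i) (sym (toℕ-fromℕ< d<n)) returns
    where
    d<n : d < n
    d<n = ≤-trans d<r₂ (s≤s⁻¹ (toℕ<n r₂))

  -- The cycle of π through i has length suc ℓ.
  Cycle : Fin n → ℕ → Set
  Cycle i ℓ = iter π (suc ℓ) i ≡ i × (∀ (t : Fin ℓ) → ¬ iter π (suc (toℕ t)) i ≡ i)

  cycle? : ∀ i ℓ → Dec (Cycle i ℓ)
  cycle? i ℓ = (iter π (suc ℓ) i ≟ i) ×-dec all? (λ t → ¬? (iter π (suc (toℕ t)) i ≟ i))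

  Cycle-minimal : ∀ {i ℓ d} → Cycle i ℓ → 0 < d → d ≤ ℓ → ¬ iter π d i ≡ i
  Cycle-minimal {i} {d = suc d} (_ , minimal) _ d<ℓ =
    subst (λ t → ¬ iter π (suc t) i ≡ i) (toℕ-fromℕ< d<ℓ) (minimal (fromℕ< d<ℓ))

  Cycle-unique : ∀ {i ℓ ℓ′} → Cycle i ℓ → Cycle i ℓ′ → ℓ ≡ ℓ′
  Cycle-unique {ℓ = ℓ} {ℓ′} c c′ with <-cmp ℓ ℓ′
  ... | tri< ℓ<ℓ′ _ _ = ⊥-elim (Cycle-minimal c′ (s≤s z≤n) ℓ<ℓ′ (proj₁ c))
  ... | tri≈ _ ℓ≡ℓ′ _ = ℓ≡ℓ′
  ... | tri> _ _ ℓ′<ℓ = ⊥-elim (Cycle-minimal c (s≤s z≤n) ℓ′<ℓ (proj₁ c′))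

  cycle-exists : IsPerm π → ∀ i → ∃ λ (ℓ : Fin n) → Cycle i (toℕ ℓ)
  cycle-exists perm i with ¬∀⟶∃¬-smallest n _ (λ t → ¬? (iter π (suc (toℕ t)) i ≟ i)) never-returns
    where
    never-returns : ¬ (∀ t → ¬ iter π (suc (toℕ t)) i ≡ i)
    never-returns never = let t , returns = return-within perm i in never t returns
  ... | ℓ , ¬¬returns , earlier =
    ℓ , decidable-stable (_ ≟ i) ¬¬returns , λ t → subst (λ u → ¬ iter π (suc u) i ≡ i) (toℕ-inject t) (earlier t)

  orbitWord : Fin n → (ℓ : ℕ) → Vec (Fin n) ℓ
  orbitWord i ℓ = tabulateᵛ (λ t → iter π (suc (toℕ t)) i)

  Traces : ∀ {ℓ} → Fin n → Vec (Fin n) ℓ → Set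
  Traces {ℓ} i s = ∀ t → t ≤ suc ℓ → iter π t i ≡ cycleAt i s t

  FollowsCycle : ∀ {ℓ} → Fin n → Vec (Fin n) ℓ → Set
  FollowsCycle {ℓ} i s = ∀ (r : Fin (suc ℓ)) → lookup π (cycleAt i s (toℕ r)) ≡ cycleAt i s (suc (toℕ r))

  followsCycle? : ∀ {ℓ} i (s : Vec (Fin n) ℓ) → Dec (FollowsCycle i s)
  followsCycle? i s = all? (λ r → lookup π (cycleAt i s (toℕ r)) ≟ cycleAt i s (suc (toℕ r)))

  module _ {ℓ} {i : Fin n} {s : Vec (Fin n) ℓ} where

    FollowsCycle⇒Traces : FollowsCycle i s → Traces i s
    FollowsCycle⇒Traces follows zero _ = refl
    FollowsCycle⇒Traces follows (suc t) (s≤s t≤ℓ) =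
      trans (cong (lookup π) (FollowsCycle⇒Traces follows t (m≤n⇒m≤1+n t≤ℓ)))
            (subst (λ u → lookup π (cycleAt i s u) ≡ cycleAt i s (suc u)) (toℕ-fromℕ< (s≤s t≤ℓ)) (follows (fromℕ< (s≤s t≤ℓ))))

    Traces⇒FollowsCycle : Traces i s → FollowsCycle i s
    Traces⇒FollowsCycle traces r =
      trans (cong (lookup π) (sym (traces (toℕ r) (m≤n⇒m≤1+n r≤ℓ)))) (traces (suc (toℕ r)) (s≤s r≤ℓ))
      where
      r≤ℓ : toℕ r ≤ ℓ
      r≤ℓ = s≤s⁻¹ (toℕ<n r)

    Traces-% : Traces i s → ∀ t → iter π t i ≡ cycleAt i s (t % suc ℓ)
    Traces-% traces t =
      trans (iter-% (trans (traces (suc ℓ) ≤-refl) (lookupOr-length s i)) t)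
            (traces (t % suc ℓ) (<⇒≤ (m%n<n t (suc ℓ))))

    Traces-word : Traces i s → ∀ (t : Fin ℓ) → iter π (suc (toℕ t)) i ≡ lookup s t
    Traces-word traces t = trans (traces (suc (toℕ t)) (s≤s (<⇒≤ (toℕ<n t)))) (lookupOr-toℕ s i t)

    Traces⇒Cycle : InjectiveWord (i ∷ s) → Traces i s → Cycle i ℓ
    Traces⇒Cycle inj traces = trans (traces (suc ℓ) ≤-refl) (lookupOr-length s i) , returns-early
      where
      returns-early : ∀ t → ¬ iter π (suc (toℕ t)) i ≡ i
      returns-early t e with inj (suc t) zero (trans (sym (Traces-word traces t)) e)
      ... | ()

    Traces⇒orbitWord : Traces i s → orbitWord i ℓ ≡ s
    Traces⇒orbitWord traces = trans (tabulate-cong (Traces-word traces)) (tabulate∘lookup s)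

  module _ (perm : IsPerm π) {i : Fin n} {ℓ} (cycle : Cycle i ℓ) where

    Cycle⇒Traces : Traces i (orbitWord i ℓ)
    Cycle⇒Traces zero _ = refl
    Cycle⇒Traces (suc t) (s≤s t≤ℓ) with m≤n⇒m<n∨m≡n t≤ℓ
    ... | inj₁ t<ℓ = sym (begin
      lookupOr (orbitWord i ℓ) i t               ≡⟨ lookupOr-fromℕ< (orbitWord i ℓ) i t<ℓ ⟩
      lookup (orbitWord i ℓ) (fromℕ< t<ℓ)        ≡⟨ lookup∘tabulate _ (fromℕ< t<ℓ) ⟩
      iter π (suc (toℕ (fromℕ< t<ℓ))) i          ≡⟨ cong (λ u → iter π (suc u) i) (toℕ-fromℕ< t<ℓ) ⟩
      iter π (suc t) i                           ∎)
      where open ≡-Reasoning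
    ... | inj₂ refl = trans (proj₁ cycle) (sym (lookupOr-length (orbitWord i ℓ) i))

    iter-injective-on-cycle : ∀ {u v} → u ≤ ℓ → v ≤ ℓ → iter π u i ≡ iter π v i → u ≡ v
    iter-injective-on-cycle {u} {v} u≤ℓ v≤ℓ e with <-cmp u v
    ... | tri< u<v _ _ = ⊥-elim (Cycle-minimal cycle (m<n⇒0<n∸m u<v) (≤-trans (m∸n≤m v u) v≤ℓ) (iter-return perm u<v e))
    ... | tri≈ _ u≡v _ = u≡v
    ... | tri> _ _ v<u = ⊥-elim (Cycle-minimal cycle (m<n⇒0<n∸m v<u) (≤-trans (m∸n≤m u v) u≤ℓ) (iter-return perm v<u (sym e)))

    Cycle⇒InjectiveWord : ∀ {s} → Traces i s → InjectiveWord (i ∷ s)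
    Cycle⇒InjectiveWord {s} traces r r′ e = toℕ-injective (iter-injective-on-cycle (bound r) (bound r′) (begin
      iter π (toℕ r) i          ≡⟨ traces (toℕ r) (m≤n⇒m≤1+n (bound r)) ⟩
      cycleAt i s (toℕ r)       ≡⟨ lookupOr-toℕ (i ∷ s) i r ⟩
      lookup (i ∷ s) r          ≡⟨ e ⟩
      lookup (i ∷ s) r′         ≡⟨ lookupOr-toℕ (i ∷ s) i r′ ⟨
      cycleAt i s (toℕ r′)      ≡⟨ traces (toℕ r′) (m≤n⇒m≤1+n (bound r′)) ⟨
      iter π (toℕ r′) i         ∎))
      where
      open ≡-Reasoning
      bound : (r : Fin (suc ℓ)) → toℕ r ≤ ℓ
      bound r = s≤s⁻¹ (toℕ<n r)

lookupOr-injective : ∀ {n ℓ t t′} {i : Fin n} {s : Vec (Fin n) ℓ} → InjectiveWord (i ∷ s) →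
  t ≤ ℓ → t′ ≤ ℓ → lookupOr s i t ≡ lookupOr s i t′ → t ≡ t′
lookupOr-injective {t = t} {t′} {i} {s} inj t≤ℓ t′≤ℓ e with m≤n⇒m<n∨m≡n t≤ℓ | m≤n⇒m<n∨m≡n t′≤ℓ
... | inj₁ t<ℓ | inj₁ t′<ℓ = begin
  t                       ≡⟨ toℕ-fromℕ< t<ℓ ⟨
  toℕ (fromℕ< t<ℓ)        ≡⟨ cong toℕ (s-injective _ _ (trans (sym (lookupOr-fromℕ< s i t<ℓ)) (trans e (lookupOr-fromℕ< s i t′<ℓ)))) ⟩
  toℕ (fromℕ< t′<ℓ)       ≡⟨ toℕ-fromℕ< t′<ℓ ⟩
  t′                      ∎
  where
  open ≡-Reasoning
  s-injective = proj₁ (Equivalence.to InjectiveWord-∷ inj)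
... | inj₁ t<ℓ | inj₂ refl =
  ⊥-elim (proj₂ (Equivalence.to InjectiveWord-∷ inj) _ (sym (trans (sym (lookupOr-fromℕ< s i t<ℓ)) (trans e (lookupOr-length s i)))))
... | inj₂ refl | inj₁ t′<ℓ =
  ⊥-elim (proj₂ (Equivalence.to InjectiveWord-∷ inj) _ (sym (trans (sym (lookupOr-fromℕ< s i t′<ℓ)) (trans (sym e) (lookupOr-length s i)))))
... | inj₂ refl | inj₂ refl = refl

module _ {n ℓ} (i : Fin n) (s : Vec (Fin n) ℓ) (inj : InjectiveWord (i ∷ s)) where

  private
    CycleEdge : Fin n → Pred (Fin n) 0ℓ
    CycleEdge x b = ∃ λ (r : Fin (suc ℓ)) → cycleAt i s (toℕ r) ≡ x × cycleAt i s (suc (toℕ r)) ≡ b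

    source-injective : ∀ r r′ → cycleAt i s (toℕ r) ≡ cycleAt i s (toℕ r′) → r ≡ r′
    source-injective r r′ e = inj r r′ (trans (sym (lookupOr-toℕ (i ∷ s) i r)) (trans e (lookupOr-toℕ (i ∷ s) i r′)))

    target-injective : ∀ r r′ → cycleAt i s (suc (toℕ r)) ≡ cycleAt i s (suc (toℕ r′)) → r ≡ r′
    target-injective r r′ e = toℕ-injective (lookupOr-injective inj (s≤s⁻¹ (toℕ<n r)) (s≤s⁻¹ (toℕ<n r′)) e)

    cycleEdge-partialInjection : IsPartialInjection (λ _ → ⊥) CycleEdge
    cycleEdge-partialInjection = record { functional = functional ; injective = injective ; avoids = λ _ () }
      where
      functional : ∀ {x b c} → CycleEdge x b → CycleEdge x c → b ≡ c
      functional (r , x≡ , b≡) (r′ , x≡′ , c≡) with source-injective r r′ (trans x≡ (sym x≡′))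
      ... | refl = trans (sym b≡) c≡
      injective : ∀ {x x′ b} → CycleEdge x b → CycleEdge x′ b → x ≡ x′
      injective (r , x≡ , b≡) (r′ , x≡′ , b≡′) with target-injective r r′ (trans b≡ (sym b≡′))
      ... | refl = trans (sym x≡) x≡′

    nowhere? : Decidable {A = Fin n} (λ _ → ⊥)
    nowhere? _ = no λ ()

  -- π follows the cycle iff it is a permutation extending the successor map of the cycle, whose domain
  -- and range are both the suc ℓ points of the cycle.
  count-followers : length (filter (λ π → isPerm? π ×-dec followsCycle? π i s) (allVecs n n)) ≡ (n ∸ suc ℓ) !
  count-followers = begin
    length (filter (λ π → isPerm? π ×-dec followsCycle? π i s) (allVecs n n))
      ≡⟨ length-filter-≐ followers? (injectiveExtension? nowhere? CycleEdge?) ((λ {π} → to {π}) , (λ {π} → from {π})) (allVecs n n) ⟩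
    length (filter (injectiveExtension? nowhere? CycleEdge?) (allVecs n n))
      ≡⟨ count-injectiveExtensions n nowhere? CycleEdge? cycleEdge-partialInjection
           targets? (targets⊆ , ⊆targets) sources? ((λ (r , e) → _ , r , e , refl) , λ (_ , r , e , _) → r , e) ⟩
    (n ∸ # targets?) P (n ∸ # sources?)
      ≡⟨ cong₂ (λ a b → (n ∸ a) P (n ∸ b)) (#-image _ target-injective targets? ((λ x → x) , (λ x → x)))
                                          (#-image _ source-injective sources? ((λ x → x) , (λ x → x))) ⟩
    (n ∸ suc ℓ) P (n ∸ suc ℓ)
      ≡⟨ nPn≡n! (n ∸ suc ℓ) ⟩
    (n ∸ suc ℓ) !
      ∎
    where
    open ≡-Reasoning
    followers? : Decidable (λ π → IsPerm π × FollowsCycle π i s)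
    followers? π = isPerm? π ×-dec followsCycle? π i s
    CycleEdge? : ∀ x → Decidable (CycleEdge x)
    CycleEdge? x b = any? (λ r → (cycleAt i s (toℕ r) ≟ x) ×-dec (cycleAt i s (suc (toℕ r)) ≟ b))
    targets? : Decidable (λ b → ∃ λ r → cycleAt i s (suc (toℕ r)) ≡ b)
    targets? b = any? (λ r → cycleAt i s (suc (toℕ r)) ≟ b)
    sources? : Decidable (λ x → ∃ λ r → cycleAt i s (toℕ r) ≡ x)
    sources? x = any? (λ r → cycleAt i s (toℕ r) ≟ x)
    targets⊆ : (λ b → ∃ λ r → cycleAt i s (suc (toℕ r)) ≡ b) ⊆ (λ _ → ⊥) ∪ Range CycleEdge
    targets⊆ (r , e) = inj₂ (_ , r , refl , e)
    ⊆targets : (λ _ → ⊥) ∪ Range CycleEdge ⊆ (λ b → ∃ λ r → cycleAt i s (suc (toℕ r)) ≡ b)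
    ⊆targets (inj₂ (_ , r , _ , e)) = r , e
    to : ∀ {π} → IsPerm π × FollowsCycle π i s → InjectiveExtension (λ _ → ⊥) CycleEdge π
    to {π} (perm , follows) = perm , (λ _ ()) , λ x b (r , x≡ , b≡) → trans (cong (lookup π) (sym x≡)) (trans (follows r) b≡)
    from : ∀ {π} → InjectiveExtension (λ _ → ⊥) CycleEdge π → IsPerm π × FollowsCycle π i s
    from (perm , _ , ext) = perm , λ r → ext _ _ (r , refl , refl)

CycleWord : ∀ {n ℓ} (i j y : Fin n) (r₁ r₂ : ℕ) → Pred (Vec (Fin n) ℓ) 0ℓ
CycleWord i j y r₁ r₂ s = InjectiveWord (i ∷ s) × cycleAt i s r₁ ≡ j × cycleAt i s r₂ ≡ y

cycleWord? : ∀ {n ℓ} (i j y : Fin n) (r₁ r₂ : ℕ) → Decidable (CycleWord {ℓ = ℓ} i j y r₁ r₂)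
cycleWord? i j y r₁ r₂ s = injectiveWord? (i ∷ s) ×-dec (cycleAt i s r₁ ≟ j) ×-dec (cycleAt i s r₂ ≟ y)

module _ {n ℓ} {i j y : Fin n} (i≢j : ¬ i ≡ j) (y≢i : ¬ y ≡ i) (y≢j : ¬ y ≡ j)
         {a b} (a<ℓ : a < ℓ) (b<ℓ : b < ℓ) (a≢b : ¬ a ≡ b) where

  private
    pa pb : Fin ℓ
    pa = fromℕ< a<ℓ
    pb = fromℕ< b<ℓ

    pa≢pb : ¬ pa ≡ pb
    pa≢pb e = a≢b (trans (sym (toℕ-fromℕ< a<ℓ)) (trans (cong toℕ e) (toℕ-fromℕ< b<ℓ)))

    Prescribed : Fin ℓ → Pred (Fin n) 0ℓ
    Prescribed p c = (p ≡ pa × j ≡ c) ⊎ (p ≡ pb × y ≡ c)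

    prescribed? : ∀ p → Decidable (Prescribed p)
    prescribed? p c = ((p ≟ pa) ×-dec (j ≟ c)) ⊎-dec ((p ≟ pb) ×-dec (y ≟ c))

    prescribed-partialInjection : IsPartialInjection ｛ i ｝ Prescribed
    prescribed-partialInjection = record { functional = functional ; injective = injective ; avoids = avoids }
      where
      functional : ∀ {p c c′} → Prescribed p c → Prescribed p c′ → c ≡ c′
      functional (inj₁ (_ , j≡c)) (inj₁ (_ , j≡c′)) = trans (sym j≡c) j≡c′
      functional (inj₁ (p≡pa , _)) (inj₂ (p≡pb , _)) = ⊥-elim (pa≢pb (trans (sym p≡pa) p≡pb))
      functional (inj₂ (p≡pb , _)) (inj₁ (p≡pa , _)) = ⊥-elim (pa≢pb (trans (sym p≡pa) p≡pb))
      functional (inj₂ (_ , y≡c)) (inj₂ (_ , y≡c′)) = trans (sym y≡c) y≡c′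
      injective : ∀ {p q c} → Prescribed p c → Prescribed q c → p ≡ q
      injective (inj₁ (p≡pa , _)) (inj₁ (q≡pa , _)) = trans p≡pa (sym q≡pa)
      injective (inj₁ (_ , j≡c)) (inj₂ (_ , y≡c)) = ⊥-elim (y≢j (trans y≡c (sym j≡c)))
      injective (inj₂ (_ , y≡c)) (inj₁ (_ , j≡c)) = ⊥-elim (y≢j (trans y≡c (sym j≡c)))
      injective (inj₂ (p≡pb , _)) (inj₂ (q≡pb , _)) = trans p≡pb (sym q≡pb)
      avoids : ∀ {p c} → Prescribed p c → ¬ i ≡ c
      avoids (inj₁ (_ , j≡c)) i≡c = i≢j (trans i≡c (sym j≡c))
      avoids (inj₂ (_ , y≡c)) i≡c = y≢i (trans y≡c (sym i≡c))

    blocked? : Decidable ((｛ i ｝ ∪ ｛ j ｝) ∪ ｛ y ｝)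
    blocked? = ((i ≟_) ∪? (j ≟_)) ∪? (y ≟_)

    blocked≐ : (｛ i ｝ ∪ ｛ j ｝) ∪ ｛ y ｝ ≐ ｛ i ｝ ∪ Range Prescribed
    blocked≐ = to , from
      where
      to : (｛ i ｝ ∪ ｛ j ｝) ∪ ｛ y ｝ ⊆ ｛ i ｝ ∪ Range Prescribed
      to (inj₁ (inj₁ i≡c)) = inj₁ i≡c
      to (inj₁ (inj₂ j≡c)) = inj₂ (pa , inj₁ (refl , j≡c))
      to (inj₂ y≡c) = inj₂ (pb , inj₂ (refl , y≡c))
      from : ｛ i ｝ ∪ Range Prescribed ⊆ (｛ i ｝ ∪ ｛ j ｝) ∪ ｛ y ｝
      from (inj₁ i≡c) = inj₁ (inj₁ i≡c)
      from (inj₂ (_ , inj₁ (_ , j≡c))) = inj₁ (inj₂ j≡c)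
      from (inj₂ (_ , inj₂ (_ , y≡c))) = inj₂ y≡c

    #blocked : # blocked? ≡ 3
    #blocked = begin
      # blocked?                                  ≡⟨ #-∪ ((i ≟_) ∪? (j ≟_)) (y ≟_) i,j≢y ⟩
      # ((i ≟_) ∪? (j ≟_)) + # (y ≟_)             ≡⟨ cong (_+ # (y ≟_)) (#-∪ (i ≟_) (j ≟_) (λ i≡c j≡c → i≢j (trans i≡c (sym j≡c)))) ⟩
      # (i ≟_) + # (j ≟_) + # (y ≟_)              ≡⟨ cong₂ _+_ (cong₂ _+_ (#-singleton i) (#-singleton j)) (#-singleton y) ⟩
      3                                           ∎
      where
      open ≡-Reasoning
      i,j≢y : ∀ {c} → (｛ i ｝ ∪ ｛ j ｝) c → ¬ y ≡ c
      i,j≢y (inj₁ i≡c) y≡c = y≢i (trans y≡c (sym i≡c))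
      i,j≢y (inj₂ j≡c) y≡c = y≢j (trans y≡c (sym j≡c))

    positions? : Decidable (｛ pa ｝ ∪ ｛ pb ｝)
    positions? = (pa ≟_) ∪? (pb ≟_)

    positions≐ : ｛ pa ｝ ∪ ｛ pb ｝ ≐ Dom Prescribed
    positions≐ = to , from
      where
      to : ｛ pa ｝ ∪ ｛ pb ｝ ⊆ Dom Prescribed
      to (inj₁ pa≡p) = j , inj₁ (sym pa≡p , refl)
      to (inj₂ pb≡p) = y , inj₂ (sym pb≡p , refl)
      from : Dom Prescribed ⊆ ｛ pa ｝ ∪ ｛ pb ｝
      from (_ , inj₁ (p≡pa , _)) = inj₁ (sym p≡pa)
      from (_ , inj₂ (p≡pb , _)) = inj₂ (sym p≡pb)

    #positions : # positions? ≡ 2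
    #positions = trans (#-∪ (pa ≟_) (pb ≟_) (λ pa≡p pb≡p → pa≢pb (trans pa≡p (sym pb≡p))))
                       (cong₂ _+_ (#-singleton pa) (#-singleton pb))

    extension≐ : InjectiveExtension ｛ i ｝ Prescribed ≐ CycleWord i j y (suc a) (suc b)
    extension≐ = to , from
      where
      to : InjectiveExtension ｛ i ｝ Prescribed ⊆ CycleWord i j y (suc a) (suc b)
      to {s} (inj , avoid , ext) =
        Equivalence.from InjectiveWord-∷ (inj , avoid) ,
        trans (lookupOr-fromℕ< s i a<ℓ) (ext pa j (inj₁ (refl , refl))) ,
        trans (lookupOr-fromℕ< s i b<ℓ) (ext pb y (inj₂ (refl , refl)))
      from : CycleWord i j y (suc a) (suc b) ⊆ InjectiveExtension ｛ i ｝ Prescribed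
      from {s} (inj∷ , at-a , at-b) = proj₁ (Equivalence.to InjectiveWord-∷ inj∷) , proj₂ (Equivalence.to InjectiveWord-∷ inj∷) , ext
        where
        ext : ∀ p c → Prescribed p c → lookup s p ≡ c
        ext _ _ (inj₁ (refl , refl)) = trans (sym (lookupOr-fromℕ< s i a<ℓ)) at-a
        ext _ _ (inj₂ (refl , refl)) = trans (sym (lookupOr-fromℕ< s i b<ℓ)) at-b

  count-cycleWords : length (filter (cycleWord? i j y (suc a) (suc b)) (allVecs ℓ n)) ≡ (n ∸ 3) P (ℓ ∸ 2)
  count-cycleWords = begin
    length (filter (cycleWord? i j y (suc a) (suc b)) (allVecs ℓ n))
      ≡⟨ length-filter-≐ _ _ (proj₂ extension≐ , proj₁ extension≐) (allVecs ℓ n) ⟩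
    length (filter (injectiveExtension? (i ≟_) prescribed?) (allVecs ℓ n))
      ≡⟨ count-injectiveExtensions ℓ (i ≟_) prescribed? prescribed-partialInjection blocked? blocked≐ positions? positions≐ ⟩
    (n ∸ # blocked?) P (ℓ ∸ # positions?)
      ≡⟨ cong₂ (λ u v → (n ∸ u) P (ℓ ∸ v)) #blocked #positions ⟩
    (n ∸ 3) P (ℓ ∸ 2)
      ∎
    where open ≡-Reasoning

module _ {n} {i j y : Fin n} (i≢j : ¬ i ≡ j) (y≢i : ¬ y ≡ i) (y≢j : ¬ y ≡ j) (k : ℕ) {ℓ} (ℓ<n : ℓ < n) where

  private
    L = suc ℓ

    distinct-positions : ∀ r₁ r₂ → r₁ < L → r₂ < L → ¬ r₁ ≡ 0 → ¬ r₂ ≡ 0 → ¬ r₁ ≡ r₂ →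
      length (filter (cycleWord? i j y r₁ r₂) (allVecs ℓ n)) * (n ∸ L) ! ≡ (n ∸ 3) !
    distinct-positions zero _ _ _ r₁≢0 _ _ = ⊥-elim (r₁≢0 refl)
    distinct-positions _ zero _ _ _ r₂≢0 _ = ⊥-elim (r₂≢0 refl)
    distinct-positions (suc a) (suc b) (s≤s a<ℓ) (s≤s b<ℓ) _ _ r₁≢r₂ =
      trans (cong (_* (n ∸ L) !) (count-cycleWords i≢j y≢i y≢j a<ℓ b<ℓ (r₁≢r₂ ∘ cong suc)))
            ([n∸3]P[ℓ∸2]*[n∸1+ℓ]!≡[n∸3]! (2≤-of-distinct a<ℓ b<ℓ (r₁≢r₂ ∘ cong suc)) ℓ<n)

  -- The positions k mod L and 2k mod L are nonzero and distinct unless L ∣ 2k, as L ∣ k implies L ∣ 2k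
  -- and k ≡ 2k mod L implies L ∣ k.
  count-cycleWords-% : length (filter (cycleWord? i j y (k % L) ((k + k) % L)) (allVecs ℓ n)) * (n ∸ L) !
                         ≡ ind (¬? (L ∣? (k + k))) * (n ∸ 3) !
  count-cycleWords-% with L ∣? (k + k)
  ... | yes L∣2k = trans
    (cong (_* (n ∸ L) !) (length-filter-none _ (λ s (_ , _ , at-r₂) → y≢i (trans (sym at-r₂) (cong (cycleAt i s) (n∣m⇒m%n≡0 _ L L∣2k)))) (allVecs ℓ n)))
    (sym (cong (_* (n ∸ 3) !) (ind-no (¬? (L ∣? (k + k))) (λ L∤2k → L∤2k L∣2k))))
  ... | no L∤2k = trans
    (distinct-positions r₁ r₂ (m%n<n k L) (m%n<n (k + k) L) r₁≢0 r₂≢0 r₁≢r₂)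
    (sym (trans (cong (_* (n ∸ 3) !) (ind-yes (¬? (L ∣? (k + k))) L∤2k)) (+-identityʳ _)))
    where
    r₁ r₂ : ℕ
    r₁ = k % L
    r₂ = (k + k) % L
    r₂≡[r₁+r₁]%L : r₂ ≡ (r₁ + r₁) % L
    r₂≡[r₁+r₁]%L = %-distribˡ-+ k k L
    r₂≢0 : ¬ r₂ ≡ 0
    r₂≢0 = L∤2k ∘ m%n≡0⇒n∣m (k + k) L
    r₁≢0 : ¬ r₁ ≡ 0
    r₁≢0 r₁≡0 = r₂≢0 (trans r₂≡[r₁+r₁]%L (cong (λ r → (r + r) % L) r₁≡0))
    r₁≢r₂ : ¬ r₁ ≡ r₂
    r₁≢r₂ r₁≡r₂ = r₁≢0 ([r+r]%n≡r⇒r≡0 (m%n<n k L) (sym (trans r₁≡r₂ r₂≡[r₁+r₁]%L)))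

∑-allVecs-single : ∀ {n} m (f : Vec (Fin n) m → ℕ) (w : Vec (Fin n) m) → (∀ v → ¬ v ≡ w → f v ≡ 0) →
  ∑[ v ∈ allVecs m n ] f v ≡ f w
∑-allVecs-single zero f [] _ = +-identityʳ (f [])
∑-allVecs-single {n} (suc m) f (x ∷ w) f≡0 = begin
  ∑[ v ∈ concatMap (λ x′ → map (x′ ∷_) (allVecs m n)) (allFin n) ] f v
    ≡⟨ ∑-concatMap (allFin n) _ f ⟩
  ∑[ x′ ∈ allFin n ] ∑[ v ∈ map (x′ ∷_) (allVecs m n) ] f v
    ≡⟨ ∑-allFin n _ ⟩
  ∑[ x′ < n ] ∑[ v ∈ map (x′ ∷_) (allVecs m n) ] f v
    ≡⟨ ∑<-single _ x (λ x′ x′≢x → trans (∑-map (allVecs m n) (x′ ∷_) f) (∑-zero (allVecs m n) (λ v → f≡0 _ (x′≢x ∘ ∷-injectiveˡ)))) ⟩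
  ∑[ v ∈ map (x ∷_) (allVecs m n) ] f v
    ≡⟨ ∑-map (allVecs m n) (x ∷_) f ⟩
  ∑[ v ∈ allVecs m n ] f (x ∷ v)
    ≡⟨ ∑-allVecs-single m (f ∘ (x ∷_)) w (λ v v≢w → f≡0 _ (v≢w ∘ ∷-injectiveʳ)) ⟩
  f (x ∷ w)
    ∎
  where open ≡-Reasoning

module _ {n} (i : Fin n) where

  count-by-cycleLength : {Q : Pred (Vec (Fin n) n) q} (Q? : Decidable Q) → (∀ {π} → Q π → IsPerm π) →
    (xs : List (Vec (Fin n) n)) →
    length (filter Q? xs) ≡ ∑[ ℓ ∈ allFin n ] length (filter (λ π → Q? π ×-dec cycle? π i (toℕ ℓ)) xs)
  count-by-cycleLength {Q = Q} Q? Q⇒perm = length-filter-partition Q? (λ ℓ π → Q? π ×-dec cycle? π i (toℕ ℓ)) (allFin n) cover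
    where
    cover : ∀ π → ∑[ ℓ ∈ allFin n ] ind (Q? π ×-dec cycle? π i (toℕ ℓ)) ≡ ind (Q? π)
    cover π with Q? π
    ... | no ¬q = ∑-zero (allFin n) (λ ℓ → ind-no (no ¬q ×-dec cycle? π i (toℕ ℓ)) (¬q ∘ proj₁))
    ... | yes q with cycle-exists π (Q⇒perm q) i
    ...   | ℓ₀ , c₀ = trans (∑-allFin n _) (trans (∑<-single _ ℓ₀ other-lengths) (ind-yes (yes q ×-dec cycle? π i (toℕ ℓ₀)) (q , c₀)))
      where
      other-lengths : ∀ ℓ → ¬ ℓ ≡ ℓ₀ → ind (yes q ×-dec cycle? π i (toℕ ℓ)) ≡ 0
      other-lengths ℓ ℓ≢ℓ₀ = ind-no (yes q ×-dec cycle? π i (toℕ ℓ)) (λ (_ , c) → ℓ≢ℓ₀ (toℕ-injective (Cycle-unique π c c₀)))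

  count-by-orbitWord : ∀ ℓ {Q : Pred (Vec (Fin n) n) q} (Q? : Decidable Q) (xs : List (Vec (Fin n) n)) →
    length (filter Q? xs) ≡ ∑[ s ∈ allVecs ℓ n ] length (filter (λ π → Q? π ×-dec ≡-decᵛ _≟_ (orbitWord π i ℓ) s) xs)
  count-by-orbitWord ℓ Q? = length-filter-partition Q? (λ s π → Q? π ×-dec ≡-decᵛ _≟_ (orbitWord π i ℓ) s) (allVecs ℓ n) cover
    where
    cover : ∀ π → ∑[ s ∈ allVecs ℓ n ] ind (Q? π ×-dec ≡-decᵛ _≟_ (orbitWord π i ℓ) s) ≡ ind (Q? π)
    cover π = trans
      (∑-allVecs-single ℓ _ (orbitWord π i ℓ) (λ s s≢w → ind-no (Q? π ×-dec ≡-decᵛ _≟_ (orbitWord π i ℓ) s) (s≢w ∘ sym ∘ proj₂)))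
      (ind-cong (Q? π ×-dec ≡-decᵛ _≟_ (orbitWord π i ℓ) (orbitWord π i ℓ)) (Q? π) proj₁ (_, refl))

module _ {n} (k : ℕ) {i j y : Fin n} (i≢j : ¬ i ≡ j) (y≢i : ¬ y ≡ i) (y≢j : ¬ y ≡ j) where

  private
    Hits : Pred (Vec (Fin n) n) 0ℓ
    Hits π = IsPerm π × iter π k i ≡ j × iter π k j ≡ y

    hits? : Decidable Hits
    hits? π = isPerm? π ×-dec (iter π k i ≟ j) ×-dec (iter π k j ≟ y)

    hitsAlong? : ∀ ℓ (s : Vec (Fin n) ℓ) → Decidable (λ π → (Hits π × Cycle π i ℓ) × orbitWord π i ℓ ≡ s)
    hitsAlong? ℓ s π = (hits? π ×-dec cycle? π i ℓ) ×-dec ≡-decᵛ _≟_ (orbitWord π i ℓ) s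

    hits⇔positions : ∀ {π ℓ} {s : Vec (Fin n) ℓ} → Traces π i s →
      (iter π k i ≡ j × iter π k j ≡ y) ⇔ (cycleAt i s (k % suc ℓ) ≡ j × cycleAt i s ((k + k) % suc ℓ) ≡ y)
    hits⇔positions {π} traces = mk⇔
      (λ (πᵏi≡j , πᵏj≡y) → trans (sym (Traces-% π traces k)) πᵏi≡j ,
                           trans (sym (Traces-% π traces (k + k))) (trans (iter-+ π k k i) (trans (cong (iter π k) πᵏi≡j) πᵏj≡y)))
      (λ (at-r₁ , at-r₂) → trans (Traces-% π traces k) at-r₁ ,
                           trans (cong (iter π k) (sym (trans (Traces-% π traces k) at-r₁)))
                                 (trans (sym (iter-+ π k k i)) (trans (Traces-% π traces (k + k)) at-r₂)))

    fibre : ∀ ℓ (s : Vec (Fin n) ℓ) → length (filter (hitsAlong? ℓ s) (allVecs n n))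
              ≡ ind (cycleWord? i j y (k % suc ℓ) ((k + k) % suc ℓ) s) * (n ∸ suc ℓ) !
    fibre ℓ s with cycleWord? i j y (k % suc ℓ) ((k + k) % suc ℓ) s
    ... | yes (inj , positions) = begin
      length (filter (hitsAlong? ℓ s) (allVecs n n))
        ≡⟨ length-filter-≐ (hitsAlong? ℓ s) (λ π → isPerm? π ×-dec followsCycle? π i s) ((λ {π} → to {π}) , (λ {π} → from {π})) (allVecs n n) ⟩
      length (filter (λ π → isPerm? π ×-dec followsCycle? π i s) (allVecs n n))
        ≡⟨ count-followers i s inj ⟩
      (n ∸ suc ℓ) !
        ≡⟨ +-identityʳ _ ⟨
      1 * (n ∸ suc ℓ) !
        ≡⟨ cong (_* (n ∸ suc ℓ) !) (ind-yes (cycleWord? i j y (k % suc ℓ) ((k + k) % suc ℓ) s) (inj , positions)) ⟨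
      ind (cycleWord? i j y (k % suc ℓ) ((k + k) % suc ℓ) s) * (n ∸ suc ℓ) !
        ∎
      where
      open ≡-Reasoning
      to : ∀ {π} → (Hits π × Cycle π i ℓ) × orbitWord π i ℓ ≡ s → IsPerm π × FollowsCycle π i s
      to {π} (((perm , _) , cycle) , refl) = perm , Traces⇒FollowsCycle π (Cycle⇒Traces π perm cycle)
      from : ∀ {π} → IsPerm π × FollowsCycle π i s → (Hits π × Cycle π i ℓ) × orbitWord π i ℓ ≡ s
      from {π} (perm , follows) =
        ((perm , Equivalence.from (hits⇔positions traces) positions) , Traces⇒Cycle π inj traces) , Traces⇒orbitWord π traces
        where
        traces = FollowsCycle⇒Traces π follows
    ... | no ¬word = trans (length-filter-none (hitsAlong? ℓ s) word (allVecs n n))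
      (sym (cong (_* (n ∸ suc ℓ) !) (ind-no (cycleWord? i j y (k % suc ℓ) ((k + k) % suc ℓ) s) ¬word)))
      where
      word : ∀ π → ¬ ((Hits π × Cycle π i ℓ) × orbitWord π i ℓ ≡ s)
      word π (((perm , hits) , cycle) , refl) =
        ¬word (Cycle⇒InjectiveWord π perm cycle traces , Equivalence.to (hits⇔positions traces) hits)
        where
        traces = Cycle⇒Traces π perm cycle

    count-with-cycleLength : ∀ {ℓ} → ℓ < n →
      length (filter (λ π → hits? π ×-dec cycle? π i ℓ) (allVecs n n)) ≡ ind (¬? (suc ℓ ∣? (k + k))) * (n ∸ 3) !
    count-with-cycleLength {ℓ} ℓ<n = begin
      length (filter (λ π → hits? π ×-dec cycle? π i ℓ) (allVecs n n))
        ≡⟨ count-by-orbitWord i ℓ (λ π → hits? π ×-dec cycle? π i ℓ) (allVecs n n) ⟩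
      ∑[ s ∈ allVecs ℓ n ] length (filter (hitsAlong? ℓ s) (allVecs n n))
        ≡⟨ ∑-cong (allVecs ℓ n) (fibre ℓ) ⟩
      ∑[ s ∈ allVecs ℓ n ] (ind (word? s) * (n ∸ suc ℓ) !)
        ≡⟨ ∑-*ʳ (allVecs ℓ n) (ind ∘ word?) ((n ∸ suc ℓ) !) ⟩
      (∑[ s ∈ allVecs ℓ n ] ind (word? s)) * (n ∸ suc ℓ) !
        ≡⟨ cong (_* (n ∸ suc ℓ) !) (∑-ind word? (allVecs ℓ n)) ⟩
      length (filter word? (allVecs ℓ n)) * (n ∸ suc ℓ) !
        ≡⟨ count-cycleWords-% i≢j y≢i y≢j k ℓ<n ⟩
      ind (¬? (suc ℓ ∣? (k + k))) * (n ∸ 3) !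
        ∎
      where
      open ≡-Reasoning
      word? = cycleWord? i j y (k % suc ℓ) ((k + k) % suc ℓ)

  count-by-nondivisors : count n k i j y ≡ # (λ (ℓ : Fin n) → ¬? (suc (toℕ ℓ) ∣? (k + k))) * (n ∸ 3) !
  count-by-nondivisors = begin
    count n k i j y
      ≡⟨ length-filter-filter _ isPerm? (allVecs n n) ⟩
    length (filter hits? (allVecs n n))
      ≡⟨ count-by-cycleLength i hits? proj₁ (allVecs n n) ⟩
    ∑[ ℓ ∈ allFin n ] length (filter (λ π → hits? π ×-dec cycle? π i (toℕ ℓ)) (allVecs n n))
      ≡⟨ ∑-cong (allFin n) (λ ℓ → count-with-cycleLength (toℕ<n ℓ)) ⟩
    ∑[ ℓ ∈ allFin n ] (ind (¬? (suc (toℕ ℓ) ∣? (k + k))) * (n ∸ 3) !)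
      ≡⟨ ∑-allFin n _ ⟩
    ∑[ ℓ < n ] (ind (¬? (suc (toℕ ℓ) ∣? (k + k))) * (n ∸ 3) !)
      ≡⟨ *-distribʳ-sum ((n ∸ 3) !) (λ (ℓ : Fin n) → ind (¬? (suc (toℕ ℓ) ∣? (k + k)))) ⟨
    # (λ (ℓ : Fin n) → ¬? (suc (toℕ ℓ) ∣? (k + k))) * (n ∸ 3) !
      ∎
    where open ≡-Reasoning

odd-coprime-2 : ∀ t → Coprime (suc (t * 2)) 2
odd-coprime-2 t {zero} (_ , 0∣2) with 0∣⇒≡0 0∣2
... | ()
odd-coprime-2 t {suc zero} _ = refl
odd-coprime-2 t {suc (suc zero)} (2∣odd , _) with trans (sym ([m+kn]%n≡m%n 1 t 2)) (n∣m⇒m%n≡0 _ 2 2∣odd)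
... | ()
odd-coprime-2 t {suc (suc (suc c))} (_ , c∣2) with ∣⇒≤ c∣2
... | s≤s (s≤s ())

odd-∣-double : ∀ t k → suc (t * 2) ∣ k * 2 → suc (t * 2) ∣ k
odd-∣-double t k d∣2k = coprime-divisor (odd-coprime-2 t) (subst (suc (t * 2) ∣_) (*-comm k 2) d∣2k)

module _ (k : ℕ) {{_ : NonZero k}} where

  private
    not-above : ∀ {m t} {{_ : NonZero m}} → ¬ suc (m + t) ∣ m
    not-above {m} {t} d∣m = <⇒≱ (s≤s (m≤m+n m t)) (∣⇒≤ d∣m)

  τₒ≡∑odd : τₒ k ≡ ∑[ t < k ] ind (suc (toℕ t * 2) ∣? k)
  τₒ≡∑odd = begin
    τₒ k                                                ≡⟨ length-filter-positives odd? k ⟩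
    ∑[ t < k ] o (toℕ t)                                ≡⟨ ∑<-truncate o (m≤m*n k 2) beyond-k ⟨
    ∑[ t < k * 2 ] o (toℕ t)                            ≡⟨ ∑<-pairs k o ⟩
    ∑[ t < k ] (o (toℕ t * 2) + o (suc (toℕ t * 2)))     ≡⟨ sum-cong-≗ {k} (λ t → pair≡ (toℕ t)) ⟩
    ∑[ t < k ] ind (suc (toℕ t * 2) ∣? k)               ∎
    where
    open ≡-Reasoning
    odd? : Decidable (λ d → d ∣ k × d % 2 ≡ 1)
    odd? d = (d ∣? k) ×-dec (d % 2 ≟ℕ 1)
    o : ℕ → ℕ
    o t = ind (odd? (suc t))
    beyond-k : ∀ t → o (k + t) ≡ 0
    beyond-k t = ind-no (odd? (suc (k + t))) (not-above ∘ proj₁)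
    pair≡ : ∀ t → o (t * 2) + o (suc (t * 2)) ≡ ind (suc (t * 2) ∣? k)
    pair≡ t = begin
      o (t * 2) + o (suc (t * 2))       ≡⟨ cong (o (t * 2) +_) (ind-no (odd? (suc t * 2)) (λ (_ , odd) → 0≢1+n (trans (sym (m*n%n≡0 (suc t) 2)) odd))) ⟩
      o (t * 2) + 0                     ≡⟨ +-identityʳ _ ⟩
      o (t * 2)                         ≡⟨ ind-cong (odd? (suc (t * 2))) (suc (t * 2) ∣? k) proj₁ (_, [m+kn]%n≡m%n 1 t 2) ⟩
      ind (suc (t * 2) ∣? k)            ∎

  -- Pair the candidates 2t + 1 and 2t + 2: the odd one divides 2k iff it divides k, and 2t + 2 ∣ 2k iff t + 1 ∣ k.
  #divisors-of-double : ∀ {n} → k * 2 ≤ n → # (λ (ℓ : Fin n) → suc (toℕ ℓ) ∣? k * 2) ≡ τ k + τₒ k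
  #divisors-of-double {n} 2k≤n = begin
    ∑[ t < n ] h (toℕ t)                                               ≡⟨ ∑<-truncate h 2k≤n beyond-2k ⟩
    ∑[ t < k * 2 ] h (toℕ t)                                           ≡⟨ ∑<-pairs k h ⟩
    ∑[ t < k ] (h (toℕ t * 2) + h (suc (toℕ t * 2)))                  ≡⟨ sum-cong-≗ {k} (λ t → pair≡ (toℕ t)) ⟩
    ∑[ t < k ] (ind (suc (toℕ t * 2) ∣? k) + ind (suc (toℕ t) ∣? k))
      ≡⟨ ∑<-distrib-+ (λ (t : Fin k) → ind (suc (toℕ t * 2) ∣? k)) (λ (t : Fin k) → ind (suc (toℕ t) ∣? k)) ⟩
    ∑[ t < k ] ind (suc (toℕ t * 2) ∣? k) + ∑[ t < k ] ind (suc (toℕ t) ∣? k)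
      ≡⟨ +-comm (∑[ t < k ] ind (suc (toℕ t * 2) ∣? k)) _ ⟩
    ∑[ t < k ] ind (suc (toℕ t) ∣? k) + ∑[ t < k ] ind (suc (toℕ t * 2) ∣? k)
      ≡⟨ cong₂ _+_ (length-filter-positives (_∣? k) k) τₒ≡∑odd ⟨
    τ k + τₒ k                                                          ∎
    where
    open ≡-Reasoning
    instance _ = m*n≢0 k 2
    h : ℕ → ℕ
    h t = ind (suc t ∣? k * 2)
    beyond-2k : ∀ t → h (k * 2 + t) ≡ 0
    beyond-2k t = ind-no (suc (k * 2 + t) ∣? k * 2) not-above
    pair≡ : ∀ t → h (t * 2) + h (suc (t * 2)) ≡ ind (suc (t * 2) ∣? k) + ind (suc t ∣? k)
    pair≡ t = cong₂ _+_ (ind-cong (suc (t * 2) ∣? k * 2) (suc (t * 2) ∣? k) (odd-∣-double t k) (λ d∣k → ∣-trans d∣k (m∣m*n 2)))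
                        (ind-cong (suc t * 2 ∣? k * 2) (suc t ∣? k) (*-cancelʳ-∣ 2) (*-monoˡ-∣ 2))

lemma2p4 : (k n : ℕ) → 1 ≤ k → 2 * k + 1 ≤ n → (i j y : Fin n) →
    ¬ i ≡ j → ¬ y ≡ i → ¬ y ≡ j →
    count n k i j y ≡ (n ∸ τ k ∸ τₒ k) * (n ∸ 3) !
lemma2p4 k@(suc _) n _ 2k+1≤n i j y i≢j y≢i y≢j = begin
  count n k i j y                                           ≡⟨ count-by-nondivisors k i≢j y≢i y≢j ⟩
  # (∁? (divides (k + k))) * (n ∸ 3) !                      ≡⟨ cong (λ m → # (∁? (divides m)) * (n ∸ 3) !) k+k≡k*2 ⟩
  # (∁? (divides (k * 2))) * (n ∸ 3) !                      ≡⟨ cong (_* (n ∸ 3) !) (#∁≡n∸# (divides (k * 2))) ⟩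
  (n ∸ # (divides (k * 2))) * (n ∸ 3) !                     ≡⟨ cong (λ m → (n ∸ m) * (n ∸ 3) !) (#divisors-of-double k 2k≤n) ⟩
  (n ∸ (τ k + τₒ k)) * (n ∸ 3) !                            ≡⟨ cong (_* (n ∸ 3) !) (∸-+-assoc n (τ k) (τₒ k)) ⟨
  (n ∸ τ k ∸ τₒ k) * (n ∸ 3) !                              ∎
  where
  open ≡-Reasoning
  divides : ∀ m → Decidable (λ (ℓ : Fin n) → suc (toℕ ℓ) ∣ m)
  divides m ℓ = suc (toℕ ℓ) ∣? m
  k+k≡k*2 : k + k ≡ k * 2
  k+k≡k*2 = trans (cong (k +_) (sym (*-identityʳ k))) (sym (*-suc k 1))
  2k≤n : k * 2 ≤ n
  2k≤n = subst (_≤ n) (*-comm 2 k) (m+n≤o⇒m≤o (2 * k) 2k+1≤n)
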